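{- Let $\ell\ge 3$ be an integer and let $T=T(1,2,\ldots,\ell)$. Then $T$ is transmission irregular if and only if $\ell\notin\{r^2+1:\ r\ge 2\}$.
   Context: All graphs are finite, simple and connected; $d_G(u,v)$ is the shortest-path distance. The transmission of a vertex $v$ of $G$ is ${\rm Tr}_G(v)=\sum_{u\in V(G)} d_G(u,v)$. A graph is transmission irregular if all its vertices have pairwise different transmissions. For $t\ge 3$ and positive integers $k_1\le\cdots\le k_t$, the starlike tree $T(k_1,\ldots,k_t)$ is the tree obtained by attaching to a single vertex $t$ pendant paths of lengths $k_1,\ldots,k_t$. -}

module Defs where

open import Data.Nat using (ℕ; zero; suc; _+_; _*_; _≡ᵇ_)
open import Data.Bool using (Bool; true; false; _∧_; _∨_; not; if_then_else_)
open import Data.Fin using (Fin; toℕ)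
open import Data.List using (List; []; _∷_; _++_; map; allFin)
open import Data.Nat.ListAction using (sum)
open import Data.Bool.ListAction using (any)
open import Relation.Binary.PropositionalEquality using (_≡_)

-- Finite simple graphs on vertex set Fin n, given by a (symmetric,
-- irreflexive) Boolean adjacency relation.

Adj : ℕ → Set
Adj n = Fin n → Fin n → Bool

reach : ∀ {n} → Adj n → ℕ → Fin n → Fin n → Bool
reach {n} G zero    u v = toℕ u ≡ᵇ toℕ v
reach {n} G (suc k) u v =
  reach G k u v ∨ any (λ w → reach G k u w ∧ G w v) (allFin n)

-- least k in [i, i + fuel) with P k, or i + fuel if none
firstFrom : (ℕ → Bool) → ℕ → ℕ → ℕ
firstFrom P i zero       = i
firstFrom P i (suc fuel) = if P i then i else firstFrom P (suc i) fuel

-- shortest-path distance d_G(u,v): the least k such that v is reachable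
-- from u by a walk of length ≤ k (searched over 0 … n; in a connected
-- graph on n vertices it is always < n).
dist : ∀ {n} → Adj n → Fin n → Fin n → ℕ
dist {n} G u v = firstFrom (λ k → reach G k u v) 0 n

Tr : ∀ {n} → Adj n → Fin n → ℕ
Tr {n} G v = sum (map (λ u → dist G u v) (allFin n))

TransmissionIrregular : ∀ {n} → Adj n → Set
TransmissionIrregular {n} G = ∀ (u v : Fin n) → Tr G u ≡ Tr G v → u ≡ v

-- Vertex 0 is the centre; the i-th pendant
-- path occupies the consecutive vertices s_i, s_i + 1, …, s_i + k_i - 1,
-- where s_1 = 1 and s_{i+1} = s_i + k_i.  Edges: centre – s_i, and
-- j – (j+1) inside each path.

starts : ℕ → List ℕ → List ℕ
starts acc []       = []
starts acc (k ∷ ks) = acc ∷ starts (acc + k) ks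

starlikeSize : List ℕ → ℕ
starlikeSize ks = suc (sum ks)

isStart : List ℕ → ℕ → Bool
isStart ks v = any (λ s → s ≡ᵇ v) (starts 1 ks)

arc : List ℕ → ℕ → ℕ → Bool
arc ks u v = ((v ≡ᵇ suc u) ∧ not (isStart ks v)) ∨ ((u ≡ᵇ 0) ∧ isStart ks v)

starlike : (ks : List ℕ) → Adj (starlikeSize ks)
starlike ks u v = arc ks (toℕ u) (toℕ v) ∨ arc ks (toℕ v) (toℕ u)

oneTo : ℕ → List ℕ
oneTo zero    = []
oneTo (suc l) = oneTo l ++ (suc l ∷ [])

-- Structure of the proof.
--  * Labels.  starlike (oneTo ℓ) numbers the centre 0 and then the branches
--    one after another; `decode` turns a label into the pair (branch length
--    K, depth j).  On such pairs the tree metric D is |i − j| on a common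
--    branch and i + j otherwise.
--  * Distance.  D changes by at most one along an edge, and every vertex
--    other than u has a neighbour one step closer to u, so walks of length t
--    reach exactly the D-ball of radius t and dist = D (module Distance).
--  * Transmission.  Summing D branch by branch gives Tr = C ℓ for the centre
--    and Tr + 2jK = C ℓ + j·tri ℓ + j² at depth j on branch K.
--  * Arithmetic.  Two branch vertices have equal transmission iff the
--    polynomial equation Balanced holds.  Comparing the depths shows it has
--    only the trivial solution unless ℓ = r² + 1, in which case an explicit
--    solution exists (square-balanced); the centre never collides.
module Submission where

open import Defs
open import Data.Bool using (Bool; true; false; if_then_else_; _∨_; T)
open import Data.Bool.ListAction using (any)
open import Data.Bool.Properties using (∨-assoc; ∨-identityʳ; ∨-zeroʳ; T-≡; T-∨; T-∧)
open import Data.Empty using (⊥; ⊥-elim)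
open import Data.Fin using (Fin; toℕ; fromℕ<)
open import Data.Fin.Properties using (toℕ-fromℕ<; toℕ-injective; toℕ<n)
open import Data.List using (List; []; _∷_; _++_; map; allFin; tabulate)
open import Data.List.Properties using (map-cong; map-tabulate)
open import Data.List.Membership.Propositional using (lose)
open import Data.List.Membership.Propositional.Properties using (∈-allFin)
open import Data.List.Relation.Unary.Any using (satisfied)
open import Data.List.Relation.Unary.Any.Properties using (any⁺; any⁻)
open import Data.Nat
open import Data.Nat.ListAction using (sum)
open import Data.Nat.ListAction.Properties using (sum-++)
open import Data.Nat.Properties
open import Data.Nat.Tactic.RingSolver using (solve-∀)
open import Data.Product using (∃-syntax; _×_; _,_; proj₁; proj₂)
open import Data.Sum using (_⊎_; inj₁; inj₂)
open import Function.Base using (_∘_)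
open import Function.Bundles using (_⇔_; mk⇔; Equivalence)
open import Relation.Binary.Definitions using (tri<; tri≈; tri>)
open import Relation.Binary.PropositionalEquality
open import Relation.Nullary using (¬_; yes; no)

tri : ℕ → ℕ
tri zero    = 0
tri (suc k) = tri k + suc k

tri-double : ∀ k → tri k + tri k ≡ k * k + k
tri-double zero    = refl
tri-double (suc k) = begin
  tri k + suc k + (tri k + suc k) ≡⟨ regroup (tri k) k ⟩
  (tri k + tri k) + 2 * suc k     ≡⟨ cong (_+ 2 * suc k) (tri-double k) ⟩
  k * k + k + 2 * suc k           ≡⟨ square-step k ⟩
  suc k * suc k + suc k           ∎
  where
  open ≡-Reasoning
  regroup : ∀ t k → t + suc k + (t + suc k) ≡ (t + t) + 2 * suc k
  regroup = solve-∀
  square-step : ∀ k → k * k + k + 2 * suc k ≡ suc k * suc k + suc k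
  square-step = solve-∀

tri-mono : ∀ {a b} → a ≤ b → tri a ≤ tri b
tri-mono {b = zero}          z≤n     = ≤-refl
tri-mono {zero}  {suc b}     _       = z≤n
tri-mono {suc a} {suc b}     (s≤s p) = +-mono-≤ (tri-mono p) (s≤s p)

n≤tri : ∀ n → n ≤ tri n
n≤tri zero    = z≤n
n≤tri (suc n) = ≤-trans (m≤n+m (suc n) (tri n)) ≤-refl

-- For ℓ ≥ 3, 4ℓ ≤ ℓ² + ℓ = 2·tri ℓ.  It bounds all distances by tri ℓ and
-- rules out one family of transmission collisions (near-low-unbalanced).
four-ℓ≤ : ∀ ℓ → 3 ≤ ℓ → 4 * ℓ ≤ ℓ * ℓ + ℓ
four-ℓ≤ ℓ 3≤ℓ = ≤-trans (+-monoʳ-≤ ℓ (*-monoˡ-≤ ℓ 3≤ℓ)) (≤-reflexive (+-comm ℓ (ℓ * ℓ)))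

double≤tri : ∀ ℓ → 3 ≤ ℓ → ℓ + ℓ ≤ tri ℓ
double≤tri ℓ 3≤ℓ = *-cancelˡ-≤ 2 (begin
  2 * (ℓ + ℓ)     ≡⟨ twice ℓ ⟩
  4 * ℓ           ≤⟨ four-ℓ≤ ℓ 3≤ℓ ⟩
  ℓ * ℓ + ℓ       ≡⟨ sym (tri-double ℓ) ⟩
  tri ℓ + tri ℓ   ≡⟨ cong (tri ℓ +_) (sym (+-identityʳ (tri ℓ))) ⟩
  2 * tri ℓ       ∎)
  where
  open ≤-Reasoning
  twice : ∀ ℓ → 2 * (ℓ + ℓ) ≡ 4 * ℓ
  twice = solve-∀

square-gap : ∀ x y → x * x + y * y ≡ 2 * (x * y) + ∣ x - y ∣ * ∣ x - y ∣
square-gap zero    y       = refl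
square-gap (suc x) zero    = expand x
  where
  expand : ∀ x → suc x * suc x + 0 ≡ 2 * (suc x * 0) + suc x * suc x
  expand = solve-∀
square-gap (suc x) (suc y) = begin
  suc x * suc x + suc y * suc y              ≡⟨ shift x y ⟩
  (x * x + y * y) + 2 * (x + y + 1)          ≡⟨ cong (_+ 2 * (x + y + 1)) (square-gap x y) ⟩
  2 * (x * y) + g * g + 2 * (x + y + 1)      ≡⟨ unshift x y (g * g) ⟩
  2 * (suc x * suc y) + g * g                ∎
  where
  open ≡-Reasoning
  g = ∣ x - y ∣
  shift : ∀ x y → suc x * suc x + suc y * suc y ≡ (x * x + y * y) + 2 * (x + y + 1)
  shift = solve-∀
  unshift : ∀ x y s → 2 * (x * y) + s + 2 * (x + y + 1) ≡ 2 * (suc x * suc y) + s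
  unshift = solve-∀

sum-oneTo : ∀ ℓ → sum (oneTo ℓ) ≡ tri ℓ
sum-oneTo zero    = refl
sum-oneTo (suc ℓ) rewrite sum-++ (oneTo ℓ) (suc ℓ ∷ []) | sum-oneTo ℓ | +-identityʳ ℓ = refl

-- In starlike (oneTo ℓ) the centre is 0, and the branch of
-- length K = suc k occupies the labels tri k + 1, …, tri k + K; label
-- tri k + j is the vertex at depth j on that branch.  `decode` recovers the
-- pair (branch length, depth), with (0 , 0) for the centre.

rowSum : ℕ → ℕ → ℕ
rowSum k zero    = 0
rowSum k (suc m) = k + rowSum (suc k) m

rowSum-snoc : ∀ m k → rowSum k (suc m) ≡ rowSum k m + (k + m)
rowSum-snoc zero    k = solve-∀
rowSum-snoc (suc m) k rewrite rowSum-snoc m (suc k) = regroup k (rowSum (suc k) m) m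
  where
  regroup : ∀ k s m → k + (s + (suc k + m)) ≡ k + s + (k + suc m)
  regroup = solve-∀

tri≡rowSum : ∀ m → tri m ≡ rowSum 1 m
tri≡rowSum zero    = refl
tri≡rowSum (suc m) rewrite rowSum-snoc m 1 | tri≡rowSum m = refl

peel : ℕ → ℕ → ℕ → ℕ × ℕ
peel zero       k v = k , v
peel (suc fuel) k v = if v ≤ᵇ k then (k , v) else peel fuel (suc k) (v ∸ k)

peel-rowSum : ∀ m k j fuel → 1 ≤ j → j ≤ k + m → m ≤ fuel →
              peel fuel k (rowSum k m + j) ≡ (k + m , j)
peel-rowSum zero k j zero _ _ _ rewrite +-identityʳ k = refl
peel-rowSum zero k j (suc fuel) _ j≤k _ rewrite +-identityʳ k with j ≤ᵇ k in fits
... | true  = refl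
... | false = ⊥-elim (subst T fits (≤⇒≤ᵇ j≤k))
peel-rowSum (suc m) k j (suc fuel) 1≤j j≤ (s≤s m≤fuel)
  with (k + rowSum (suc k) m + j) ≤ᵇ k in fits
... | true  = ⊥-elim (<⇒≱ k<v (≤ᵇ⇒≤ _ _ (subst T (sym fits) _)))
  where
  k<v : k < k + rowSum (suc k) m + j
  k<v = ≤-trans (s≤s (m≤m+n k _)) (≤-trans (≤-reflexive (sym (+-comm _ 1))) (+-monoʳ-≤ _ 1≤j))
... | false
  rewrite +-assoc k (rowSum (suc k) m) j | m+n∸m≡n k (rowSum (suc k) m + j)
        | peel-rowSum m (suc k) j fuel 1≤j (subst (j ≤_) (+-suc k m) j≤) m≤fuel
  = cong (_, j) (sym (+-suc k m))

decode : ℕ → ℕ × ℕ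
decode zero    = 0 , 0
decode (suc v) = peel (suc v) 1 (suc v)

decode-node : ∀ k j → 1 ≤ j → j ≤ suc k → decode (tri k + j) ≡ (suc k , j)
decode-node k (suc j) 1≤j j≤ = begin
  decode (tri k + suc j)               ≡⟨ cong decode (+-suc (tri k) j) ⟩
  peel (suc w) 1 (suc w)               ≡⟨ cong (λ x → peel x 1 x) (sym (+-suc (tri k) j)) ⟩
  peel v 1 v                           ≡⟨ cong (λ x → peel v 1 (x + suc j)) (tri≡rowSum k) ⟩
  peel v 1 (rowSum 1 k + suc j)        ≡⟨ peel-rowSum k 1 (suc j) v 1≤j j≤ k≤v ⟩
  (suc k , suc j)                      ∎
  where
  open ≡-Reasoning
  v = tri k + suc j
  w = tri k + j
  k≤v : k ≤ v
  k≤v = ≤-trans (n≤tri k) (m≤m+n (tri k) (suc j))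

decode-depth : ∀ k j → 1 ≤ j → j ≤ suc k → proj₂ (decode (tri k + j)) ≡ j
decode-depth k j 1≤j j≤ = cong proj₂ (decode-node k j 1≤j j≤)

data Label (ℓ : ℕ) : ℕ → Set where
  centre : Label ℓ 0
  node   : ∀ k j → k < ℓ → 1 ≤ j → j ≤ suc k → Label ℓ (tri k + j)

label : ∀ ℓ v → v < suc (tri ℓ) → Label ℓ v
label zero    zero    _ = centre
label zero    (suc v) (s≤s ())
label (suc ℓ) v v< with v <? suc (tri ℓ)
... | yes v<' = widen (label ℓ v v<')
  where
  widen : ∀ {v} → Label ℓ v → Label (suc ℓ) v
  widen centre            = centre
  widen (node k j k< a b) = node k j (m≤n⇒m≤1+n k<) a b
... | no v≮ = subst (Label (suc ℓ)) (m+[n∸m]≡n (<⇒≤ past)) (node ℓ (v ∸ tri ℓ) ≤-refl (m<n⇒0<n∸m past) within)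
  where
  past : tri ℓ < v
  past = ≰⇒> (λ q → v≮ (s≤s q))
  within : v ∸ tri ℓ ≤ suc ℓ
  within = subst (v ∸ tri ℓ ≤_) (m+n∸m≡n (tri ℓ) (suc ℓ)) (∸-monoˡ-≤ (tri ℓ) (≤-pred v<))

node-bound : ∀ ℓ k j → k < ℓ → j ≤ suc k → tri k + j < suc (tri ℓ)
node-bound ℓ k j k< j≤ = s≤s (≤-trans (+-monoʳ-≤ (tri k) j≤) (tri-mono k<))

≡ᵇ-refl : ∀ n → (n ≡ᵇ n) ≡ true
≡ᵇ-refl zero    = refl
≡ᵇ-refl (suc n) = ≡ᵇ-refl n

≡ᵇ-true : ∀ a b → (a ≡ᵇ b) ≡ true → a ≡ b
≡ᵇ-true a b e = ≡ᵇ⇒≡ a b (subst T (sym e) _)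

≢⇒≡ᵇ-false : ∀ a b → a ≢ b → (a ≡ᵇ b) ≡ false
≢⇒≡ᵇ-false a b a≢b with a ≡ᵇ b in e
... | false = refl
... | true  = ⊥-elim (a≢b (≡ᵇ-true a b e))

∨-true : ∀ a b → a ∨ b ≡ true → a ≡ true ⊎ b ≡ true
∨-true true  b _ = inj₁ refl
∨-true false b e = inj₂ e

any-++ : ∀ {A : Set} (p : A → Bool) xs ys → any p (xs ++ ys) ≡ any p xs ∨ any p ys
any-++ p []       ys = refl
any-++ p (x ∷ xs) ys rewrite any-++ p xs ys = sym (∨-assoc (p x) _ _)

starts-snoc : ∀ acc xs x → starts acc (xs ++ x ∷ []) ≡ starts acc xs ++ (acc + sum xs ∷ [])
starts-snoc acc []       x = cong (_∷ []) (sym (+-identityʳ acc))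
starts-snoc acc (y ∷ xs) x rewrite starts-snoc (acc + y) xs x | +-assoc acc y (sum xs) = refl

isStart-snoc : ∀ ℓ v → isStart (oneTo (suc ℓ)) v ≡ isStart (oneTo ℓ) v ∨ (suc (tri ℓ) ≡ᵇ v)
isStart-snoc ℓ v
  rewrite starts-snoc 1 (oneTo ℓ) (suc ℓ)
        | any-++ (λ s → s ≡ᵇ v) (starts 1 (oneTo ℓ)) (1 + sum (oneTo ℓ) ∷ [])
        | sum-oneTo ℓ | ∨-identityʳ (suc (tri ℓ) ≡ᵇ v) = refl

isStart-first : ∀ ℓ v → isStart (oneTo ℓ) v ≡ true → ∃[ k ] (k < ℓ × v ≡ tri k + 1)
isStart-first zero    v ()
isStart-first (suc ℓ) v e rewrite isStart-snoc ℓ v with ∨-true _ _ e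
... | inj₁ old with isStart-first ℓ v old
...   | k , k< , v≡ = k , m≤n⇒m≤1+n k< , v≡
isStart-first (suc ℓ) v e | inj₂ new = ℓ , ≤-refl , trans (sym (≡ᵇ-true _ _ new)) (+-comm 1 (tri ℓ))

first-isStart : ∀ ℓ k → k < ℓ → isStart (oneTo ℓ) (tri k + 1) ≡ true
first-isStart (suc ℓ) k k< rewrite isStart-snoc ℓ (tri k + 1) with k ≟ ℓ
... | yes refl rewrite +-comm (tri k) 1 | ≡ᵇ-refl (suc (tri k)) = ∨-zeroʳ _
... | no k≢ℓ rewrite first-isStart ℓ k (≤∧≢⇒< (≤-pred k<) k≢ℓ) = refl

deeper-notStart : ∀ ℓ k j → 1 ≤ j → j ≤ suc k → j ≢ 1 → isStart (oneTo ℓ) (tri k + j) ≡ false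
deeper-notStart ℓ k j 1≤j j≤ j≢1 with isStart (oneTo ℓ) (tri k + j) in e
... | false = refl
... | true with isStart-first ℓ _ e
...   | k′ , _ , v≡ = ⊥-elim (j≢1 (sym (begin
  1                           ≡⟨ sym (decode-depth k′ 1 ≤-refl (s≤s z≤n)) ⟩
  proj₂ (decode (tri k′ + 1)) ≡⟨ cong (λ v → proj₂ (decode v)) (sym v≡) ⟩
  proj₂ (decode (tri k + j))  ≡⟨ decode-depth k j 1≤j j≤ ⟩
  j                           ∎)))
  where open ≡-Reasoning

-- The tree metric on (branch length, depth) pairs: two vertices on the same
-- branch are |i − j| apart, otherwise the path runs through the centre.
-- The centre (0 , 0) is at distance j from every (K , j).
D : ℕ × ℕ → ℕ × ℕ → ℕ
D (K , i) (K′ , j) = if K ≡ᵇ K′ then ∣ i - j ∣ else i + j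

D-same-branch : ∀ K i j → D (K , i) (K , j) ≡ ∣ i - j ∣
D-same-branch K i j rewrite ≡ᵇ-refl K = refl

D-other-branch : ∀ {K K′} → K ≢ K′ → ∀ i j → D (K , i) (K′ , j) ≡ i + j
D-other-branch {K} {K′} K≢K′ i j rewrite ≢⇒≡ᵇ-false K K′ K≢K′ = refl

D-refl : ∀ p → D p p ≡ 0
D-refl (K , i) = trans (D-same-branch K i i) (∣n-n∣≡0 i)

D-depth0 : ∀ p K → D p (K , 0) ≡ proj₂ p
D-depth0 (K′ , i) K with K′ ≡ᵇ K
... | true  = ∣-∣-identityʳ i
... | false = +-identityʳ i

D≤depths : ∀ p q → D p q ≤ proj₂ p + proj₂ q
D≤depths (K , i) (K′ , j) with K ≡ᵇ K′
... | true  = ≤-trans (∣m-n∣≤m⊔n i j) (m⊔n≤m+n i j)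
... | false = ≤-refl

∣-∣-sucʳ-≤ : ∀ i j → ∣ i - suc j ∣ ≤ suc ∣ i - j ∣
∣-∣-sucʳ-≤ zero    j       = ≤-refl
∣-∣-sucʳ-≤ (suc i) zero    rewrite ∣-∣-identityʳ i = m≤n⇒m≤1+n (n≤1+n i)
∣-∣-sucʳ-≤ (suc i) (suc j) = ∣-∣-sucʳ-≤ i j

∣-∣-sucʳ-≥ : ∀ i j → ∣ i - j ∣ ≤ suc ∣ i - suc j ∣
∣-∣-sucʳ-≥ zero    j       = m≤n⇒m≤1+n (n≤1+n j)
∣-∣-sucʳ-≥ (suc i) zero    rewrite ∣-∣-identityʳ i = ≤-refl
∣-∣-sucʳ-≥ (suc i) (suc j) = ∣-∣-sucʳ-≥ i j

∣-∣-sucʳ-below : ∀ i j → i ≤ j → suc ∣ i - j ∣ ≡ ∣ i - suc j ∣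
∣-∣-sucʳ-below zero    j       _       = refl
∣-∣-sucʳ-below (suc i) (suc j) (s≤s p) = ∣-∣-sucʳ-below i j p

∣-∣-sucʳ-above : ∀ i j → j < i → suc ∣ i - suc j ∣ ≡ ∣ i - j ∣
∣-∣-sucʳ-above (suc i) zero    _       = cong suc (∣-∣-identityʳ i)
∣-∣-sucʳ-above (suc i) (suc j) (s≤s p) = ∣-∣-sucʳ-above i j p

data Step : ℕ × ℕ → ℕ × ℕ → Set where
  leave  : ∀ k → Step (0 , 0) (suc k , 1)
  deeper : ∀ K j → Step (K , j) (K , suc j)

Near : ℕ → ℕ → Set
Near a b = a ≤ suc b × b ≤ suc a

D-step : ∀ {p q} → Step p q → ∀ u → Near (D u q) (D u p)
D-step (leave k) u rewrite D-depth0 u 0 with u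
... | K , i with K ≡ᵇ suc k
...   | true  = subst (λ x → ∣ i - 1 ∣ ≤ suc x) (∣-∣-identityʳ i) (∣-∣-sucʳ-≤ i 0)
              , subst (_≤ suc ∣ i - 1 ∣) (∣-∣-identityʳ i) (∣-∣-sucʳ-≥ i 0)
...   | false = ≤-reflexive (+-comm i 1) , ≤-trans (m≤m+n i 1) (n≤1+n _)
D-step (deeper K j) (K′ , i) with K′ ≡ᵇ K
... | true  = ∣-∣-sucʳ-≤ i j , ∣-∣-sucʳ-≥ i j
... | false = ≤-reflexive (+-suc i j) , ≤-trans (+-monoʳ-≤ i (n≤1+n j)) (n≤1+n _)

arc-cases : ∀ ks u v → arc ks u v ≡ true →
            (v ≡ suc u × isStart ks v ≡ false) ⊎ (u ≡ 0 × isStart ks v ≡ true)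
arc-cases ks u v e with v ≡ᵇ suc u in next | isStart ks v in start | u ≡ᵇ 0 in fromCentre
... | true  | false | _     = inj₁ (≡ᵇ-true _ _ next , refl)
... | _     | true  | true  = inj₂ (≡ᵇ-true _ _ fromCentre , refl)
arc-cases ks u v () | true  | true  | false
arc-cases ks u v () | false | true  | false
arc-cases ks u v () | false | false | true
arc-cases ks u v () | false | false | false

arc-deeper : ∀ ks x → isStart ks (suc x) ≡ false → arc ks x (suc x) ≡ true
arc-deeper ks x e rewrite e | ≡ᵇ-refl x = refl

arc-leave : ∀ ks y → isStart ks y ≡ true → arc ks 0 y ≡ true
arc-leave ks y e rewrite e = ∨-zeroʳ _

arc⇒Step : ∀ ℓ → 1 ≤ ℓ → ∀ a b → a < suc (tri ℓ) → b < suc (tri ℓ) →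
           arc (oneTo ℓ) a b ≡ true → Step (decode a) (decode b)
arc⇒Step ℓ 1≤ℓ a b a< b< e with arc-cases (oneTo ℓ) a b e
... | inj₂ (refl , start) with isStart-first ℓ b start
...   | k , _ , refl rewrite decode-node k 1 ≤-refl (s≤s z≤n) = leave k
arc⇒Step ℓ 1≤ℓ a b a< b< e | inj₁ (refl , notStart) with label ℓ a (<-trans (n<1+n a) b<)
... | centre with trans (sym (first-isStart ℓ 0 1≤ℓ)) notStart
...   | ()
arc⇒Step ℓ 1≤ℓ a b a< b< e | inj₁ (refl , notStart) | node k j k< 1≤j j≤ with j ≟ suc k
...   | no j≢ = subst₂ Step (sym (decode-node k j 1≤j j≤)) (sym child) (deeper (suc k) j)
  where
  child : decode (suc (tri k + j)) ≡ (suc k , suc j)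
  child = trans (cong decode (sym (+-suc (tri k) j))) (decode-node k (suc j) (s≤s z≤n) (≤∧≢⇒< j≤ j≢))
...   | yes refl = ⊥-elim (nextBranch (≤∧≢⇒< k< lastBranch))
  where
  -- the vertex after the end of branch k + 1 starts branch k + 2
  nextBranch : suc k < ℓ → ⊥
  nextBranch k+1< with trans (sym (first-isStart ℓ (suc k) k+1<)) (trans (cong (isStart (oneTo ℓ)) (+-comm (tri (suc k)) 1)) notStart)
  ... | ()
  lastBranch : suc k ≢ ℓ
  lastBranch refl = <-irrefl refl b<

Adjacent : ℕ → ℕ → ℕ → Set
Adjacent ℓ w v = arc (oneTo ℓ) w v ≡ true ⊎ arc (oneTo ℓ) v w ≡ true

Adjacent⇒edge : ∀ ℓ (w v : Fin (starlikeSize (oneTo ℓ))) →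
                Adjacent ℓ (toℕ w) (toℕ v) → starlike (oneTo ℓ) w v ≡ true
Adjacent⇒edge ℓ w v (inj₁ e) rewrite e = refl
Adjacent⇒edge ℓ w v (inj₂ e) rewrite e = ∨-zeroʳ _

deeper-edge : ∀ ℓ k j → 1 ≤ j → j < suc k → arc (oneTo ℓ) (tri k + j) (tri k + suc j) ≡ true
deeper-edge ℓ k j 1≤j j< = subst (λ z → arc (oneTo ℓ) (tri k + j) z ≡ true) (sym (+-suc (tri k) j))
  (arc-deeper (oneTo ℓ) _ (subst (λ z → isStart (oneTo ℓ) z ≡ false) (+-suc (tri k) j) notStart))
  where
  notStart : isStart (oneTo ℓ) (tri k + suc j) ≡ false
  notStart = deeper-notStart ℓ k (suc j) (s≤s z≤n) j< (λ j+1≡1 → <-irrefl (sym j+1≡1) (s≤s 1≤j))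

-- Closer ℓ p v: some neighbour w of v is one step closer to p than v is.
-- This is what lets walks of length t reach everything within D-distance t.
Closer : ℕ → ℕ × ℕ → ℕ → Set
Closer ℓ p v = ∃[ w ] (w < suc (tri ℓ) × Adjacent ℓ w v × suc (D p (decode w)) ≡ D p (decode v))

toward-centre : ∀ ℓ p k j → k < ℓ → j < suc k →
                suc (D p (suc k , j)) ≡ D p (suc k , suc j) → Closer ℓ p (tri k + suc j)
toward-centre ℓ p k zero k< _ e =
  0 , s≤s z≤n , inj₁ (arc-leave (oneTo ℓ) _ (first-isStart ℓ k k<)) , (begin
    suc (D p (0 , 0))         ≡⟨ cong suc (trans (D-depth0 p 0) (sym (D-depth0 p (suc k)))) ⟩
    suc (D p (suc k , 0))     ≡⟨ e ⟩
    D p (suc k , 1)           ≡⟨ cong (D p) (sym (decode-node k 1 ≤-refl (s≤s z≤n))) ⟩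
    D p (decode (tri k + 1))  ∎)
  where open ≡-Reasoning
toward-centre ℓ p k (suc j) k< j< e =
  tri k + suc j , node-bound ℓ k (suc j) k< (<⇒≤ j<) , inj₁ (deeper-edge ℓ k (suc j) (s≤s z≤n) j<) , (begin
    suc (D p (decode (tri k + suc j)))  ≡⟨ cong (λ q → suc (D p q)) (decode-node k (suc j) (s≤s z≤n) (<⇒≤ j<)) ⟩
    suc (D p (suc k , suc j))           ≡⟨ e ⟩
    D p (suc k , suc (suc j))           ≡⟨ cong (D p) (sym (decode-node k (suc (suc j)) (s≤s z≤n) j<)) ⟩
    D p (decode (tri k + suc (suc j)))  ∎)
  where open ≡-Reasoning

away-from-centre : ∀ ℓ p k j → k < ℓ → 1 ≤ j → j < suc k →
                   suc (D p (suc k , suc j)) ≡ D p (suc k , j) → Closer ℓ p (tri k + j)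
away-from-centre ℓ p k j k< 1≤j j< e =
  tri k + suc j , node-bound ℓ k (suc j) k< j< , inj₂ (deeper-edge ℓ k j 1≤j j<) , (begin
    suc (D p (decode (tri k + suc j)))  ≡⟨ cong (λ q → suc (D p q)) (decode-node k (suc j) (s≤s z≤n) j<) ⟩
    suc (D p (suc k , suc j))           ≡⟨ e ⟩
    D p (suc k , j)                     ≡⟨ cong (D p) (sym (decode-node k j 1≤j (<⇒≤ j<))) ⟩
    D p (decode (tri k + j))            ∎)
  where open ≡-Reasoning

into-centre : ∀ ℓ k i → k < ℓ → 1 ≤ i → Closer ℓ (suc k , i) 0
into-centre ℓ k (suc i) k< _ =
  tri k + 1 , node-bound ℓ k 1 k< (s≤s z≤n) , inj₂ (arc-leave (oneTo ℓ) _ (first-isStart ℓ k k<)) , (begin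
    suc (D (suc k , suc i) (decode (tri k + 1)))  ≡⟨ cong (λ q → suc (D (suc k , suc i) q)) (decode-node k 1 ≤-refl (s≤s z≤n)) ⟩
    suc (D (suc k , suc i) (suc k , 1))           ≡⟨ cong suc (D-same-branch (suc k) (suc i) 1) ⟩
    suc ∣ i - 0 ∣                                 ≡⟨ cong suc (trans (∣-∣-identityʳ i) (sym (+-identityʳ i))) ⟩
    suc (i + 0)                                   ∎)
  where open ≡-Reasoning

closer : ∀ ℓ u v → u < suc (tri ℓ) → v < suc (tri ℓ) → u ≢ v → Closer ℓ (decode u) v
closer ℓ u v u< v< u≢v with label ℓ u u< | label ℓ v v<
... | centre | centre = ⊥-elim (u≢v refl)
... | node k i k< 1≤i i≤ | centre rewrite decode-node k i 1≤i i≤ = into-centre ℓ k i k< 1≤i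
... | centre | node k (suc j) k< _ j< = toward-centre ℓ (0 , 0) k j k< j< refl
... | node k′ i k′< 1≤i i≤ | node k (suc j) k< _ j< rewrite decode-node k′ i 1≤i i≤ with suc k′ ≟ suc k
...   | no k′≢k = toward-centre ℓ (suc k′ , i) k j k< j< (begin
  suc (D (suc k′ , i) (suc k , j))  ≡⟨ cong suc (D-other-branch k′≢k i j) ⟩
  suc (i + j)                       ≡⟨ sym (+-suc i j) ⟩
  i + suc j                         ≡⟨ sym (D-other-branch k′≢k i (suc j)) ⟩
  D (suc k′ , i) (suc k , suc j)    ∎)
  where open ≡-Reasoning
...   | yes refl with <-cmp i (suc j)
...     | tri< i< _ _ = toward-centre ℓ (suc k′ , i) k′ j k< j< (begin
  suc (D (suc k′ , i) (suc k′ , j))  ≡⟨ cong suc (D-same-branch (suc k′) i j) ⟩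
  suc ∣ i - j ∣                      ≡⟨ ∣-∣-sucʳ-below i j (≤-pred i<) ⟩
  ∣ i - suc j ∣                      ≡⟨ sym (D-same-branch (suc k′) i (suc j)) ⟩
  D (suc k′ , i) (suc k′ , suc j)    ∎)
  where open ≡-Reasoning
...     | tri≈ _ refl _ = ⊥-elim (u≢v refl)
...     | tri> _ _ j<i = away-from-centre ℓ (suc k′ , i) k′ (suc j) k< (s≤s z≤n) (<-≤-trans j<i i≤) (begin
  suc (D (suc k′ , i) (suc k′ , suc (suc j)))  ≡⟨ cong suc (D-same-branch (suc k′) i (suc (suc j))) ⟩
  suc ∣ i - suc (suc j) ∣                      ≡⟨ ∣-∣-sucʳ-above i (suc j) j<i ⟩
  ∣ i - suc j ∣                                ≡⟨ sym (D-same-branch (suc k′) i (suc j)) ⟩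
  D (suc k′ , i) (suc k′ , suc j)              ∎)
  where open ≡-Reasoning

D-zero : ∀ ℓ a b → a < suc (tri ℓ) → b < suc (tri ℓ) → D (decode a) (decode b) ≡ 0 → a ≡ b
D-zero ℓ a b a< b< D≡0 with label ℓ a a< | label ℓ b b<
... | centre | centre = refl
... | centre | node k j _ 1≤j j≤ rewrite decode-node k j 1≤j j≤ = ⊥-elim (<-irrefl (sym D≡0) 1≤j)
... | node k i _ 1≤i i≤ | centre rewrite decode-node k i 1≤i i≤ =
  ⊥-elim (<-irrefl (sym (trans (sym (+-identityʳ i)) D≡0)) 1≤i)
... | node k′ i _ 1≤i i≤ | node k j _ 1≤j j≤ rewrite decode-node k′ i 1≤i i≤ | decode-node k j 1≤j j≤
  with suc k′ ≟ suc k
...   | yes refl = cong (tri k′ +_) (∣m-n∣≡0⇒m≡n (trans (sym (D-same-branch (suc k′) i j)) D≡0))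
...   | no k′≢k = ⊥-elim (<-irrefl (sym (m+n≡0⇒m≡0 i (trans (sym (D-other-branch k′≢k i j)) D≡0))) 1≤i)

depth≤ : ∀ ℓ a → a < suc (tri ℓ) → proj₂ (decode a) ≤ ℓ
depth≤ ℓ a a< with label ℓ a a<
... | centre              = z≤n
... | node k j k< 1≤j j≤ rewrite decode-depth k j 1≤j j≤ = ≤-trans j≤ k<

firstFrom-threshold : ∀ (P : ℕ → Bool) d → (∀ k → T (P k) ⇔ d ≤ k) →
                      ∀ i fuel → i ≤ d → d < i + fuel → firstFrom P i fuel ≡ d
firstFrom-threshold P d P⇔ i zero i≤d d< =
  ⊥-elim (<-irrefl refl (≤-trans d< (≤-trans (≤-reflexive (+-identityʳ i)) i≤d)))
firstFrom-threshold P d P⇔ i (suc fuel) i≤d d< with P i in e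
... | true  = ≤-antisym i≤d (Equivalence.to (P⇔ i) (subst T (sym e) _))
... | false = firstFrom-threshold P d P⇔ (suc i) fuel
                (≰⇒> (λ d≤i → subst T e (Equivalence.from (P⇔ i) d≤i)))
                (subst (d <_) (+-suc i fuel) d<)

-- In T(1,…,ℓ) the graph distance between two vertices is D of their decoded
-- labels: walks of length t reach exactly the vertices within D-distance t,
-- because D changes by at most one along an edge (D-step) and every other
-- vertex has a neighbour one step closer (closer).
module Distance (ℓ : ℕ) (3≤ℓ : 3 ≤ ℓ) where
  n : ℕ
  n = starlikeSize (oneTo ℓ)

  G : Adj n
  G = starlike (oneTo ℓ)

  1≤ℓ : 1 ≤ ℓ
  1≤ℓ = ≤-trans (s≤s z≤n) 3≤ℓ

  label< : (u : Fin n) → toℕ u < suc (tri ℓ)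
  label< u = subst (toℕ u <_) (cong suc (sum-oneTo ℓ)) (toℕ<n u)

  vertex : ∀ w → w < suc (tri ℓ) → Fin n
  vertex w w< = fromℕ< (subst (w <_) (cong suc (sym (sum-oneTo ℓ))) w<)

  vertex-label : ∀ w w< → toℕ (vertex w w<) ≡ w
  vertex-label w w< = toℕ-fromℕ< _

  pos : Fin n → ℕ × ℕ
  pos u = decode (toℕ u)

  edge-near : ∀ w v → T (G w v) → ∀ p → D p (pos v) ≤ suc (D p (pos w))
  edge-near w v e p with arc (oneTo ℓ) (toℕ w) (toℕ v) in wv
  ... | true  = proj₁ (D-step (arc⇒Step ℓ 1≤ℓ _ _ (label< w) (label< v) wv) p)
  ... | false = proj₂ (D-step (arc⇒Step ℓ 1≤ℓ _ _ (label< v) (label< w) (Equivalence.to T-≡ e)) p)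

  neighbour-closer : ∀ u v → toℕ u ≢ toℕ v →
                     ∃[ w ] (T (G w v) × suc (D (pos u) (pos w)) ≡ D (pos u) (pos v))
  neighbour-closer u v u≢v with closer ℓ (toℕ u) (toℕ v) (label< u) (label< v) u≢v
  ... | w , w< , adj , closer-eq =
    vertex w w< ,
    Equivalence.from T-≡ (Adjacent⇒edge ℓ (vertex w w<) v (subst (λ x → Adjacent ℓ x (toℕ v)) (sym w≡) adj)) ,
    trans (cong (λ x → suc (D (pos u) (decode x))) w≡) closer-eq
    where
    w≡ : toℕ (vertex w w<) ≡ w
    w≡ = vertex-label w w<

  reach⇔ : ∀ t u v → T (reach G t u v) ⇔ D (pos u) (pos v) ≤ t
  reach⇔ t u v = mk⇔ (sound t u v) (complete t u v)
    where
    sound : ∀ t u v → T (reach G t u v) → D (pos u) (pos v) ≤ t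
    sound zero u v r = ≤-reflexive (trans (cong (λ x → D (pos u) (decode x)) (sym (≡ᵇ⇒≡ (toℕ u) (toℕ v) r))) (D-refl (pos u)))
    sound (suc t) u v r with Equivalence.to T-∨ r
    ... | inj₁ r′ = m≤n⇒m≤1+n (sound t u v r′)
    ... | inj₂ r′ with satisfied (any⁻ _ (allFin n) r′)
    ...   | w , rw with Equivalence.to T-∧ rw
    ...     | uw , wv = ≤-trans (edge-near w v wv (pos u)) (s≤s (sound t u w uw))
    complete : ∀ t u v → D (pos u) (pos v) ≤ t → T (reach G t u v)
    complete zero u v D≤0 = ≡⇒≡ᵇ _ _ (D-zero ℓ _ _ (label< u) (label< v) (n≤0⇒n≡0 D≤0))
    complete (suc t) u v D≤ with D (pos u) (pos v) ≤? t
    ... | yes D≤t = Equivalence.from (T-∨ {reach G t u v}) (inj₁ (complete t u v D≤t))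
    ... | no D≰t with neighbour-closer u v (λ u≡v → D≰t (≤-trans (≤-reflexive (D-same-label u≡v)) z≤n))
      where
      D-same-label : toℕ u ≡ toℕ v → D (pos u) (pos v) ≡ 0
      D-same-label u≡v = trans (cong (λ x → D (pos u) (decode x)) (sym u≡v)) (D-refl (pos u))
    ...   | w , wv , closer-eq = Equivalence.from (T-∨ {reach G t u v}) (inj₂ (any⁺ _ (lose (∈-allFin w)
              (Equivalence.from (T-∧ {reach G t u w}) (complete t u w (≤-pred (≤-trans (≤-reflexive closer-eq) D≤)) , wv)))))

  -- D is below the number of vertices, so the search in `dist` finds it.
  D<n : ∀ u v → D (pos u) (pos v) < n
  D<n u v = s≤s (begin
    D (pos u) (pos v)              ≤⟨ D≤depths (pos u) (pos v) ⟩
    proj₂ (pos u) + proj₂ (pos v)  ≤⟨ +-mono-≤ (depth≤ ℓ _ (label< u)) (depth≤ ℓ _ (label< v)) ⟩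
    ℓ + ℓ                          ≤⟨ double≤tri ℓ 3≤ℓ ⟩
    tri ℓ                          ≡⟨ sym (sum-oneTo ℓ) ⟩
    sum (oneTo ℓ)                  ∎)
    where open ≤-Reasoning

  dist-eq : ∀ u v → dist G u v ≡ D (pos u) (pos v)
  dist-eq u v = firstFrom-threshold (λ k → reach G k u v) _ (λ k → reach⇔ k u v) 0 n z≤n (D<n u v)

sumBelow : ℕ → (ℕ → ℕ) → ℕ
sumBelow zero    g = 0
sumBelow (suc m) g = g 0 + sumBelow m (λ i → g (suc i))

sumBelow-snoc : ∀ m g → sumBelow (suc m) g ≡ sumBelow m g + g m
sumBelow-snoc zero    g = +-comm (g 0) 0
sumBelow-snoc (suc m) g rewrite sumBelow-snoc m (λ i → g (suc i)) = sym (+-assoc (g 0) _ _)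

sumBelow-+ : ∀ a b g → sumBelow (a + b) g ≡ sumBelow a g + sumBelow b (λ i → g (a + i))
sumBelow-+ zero    b g = refl
sumBelow-+ (suc a) b g rewrite sumBelow-+ a b (λ i → g (suc i)) = sym (+-assoc (g 0) _ _)

sumBelow-cong : ∀ m {f g} → (∀ i → i < m → f i ≡ g i) → sumBelow m f ≡ sumBelow m g
sumBelow-cong zero    f≡g = refl
sumBelow-cong (suc m) f≡g = cong₂ _+_ (f≡g 0 (s≤s z≤n)) (sumBelow-cong m (λ i i< → f≡g (suc i) (s≤s i<)))

sum-tabulate : ∀ m (g : ℕ → ℕ) → sum (tabulate {n = m} (λ i → g (toℕ i))) ≡ sumBelow m g
sum-tabulate zero    g = refl
sum-tabulate (suc m) g = cong (g 0 +_) (sum-tabulate m (λ i → g (suc i)))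

sumBelow-shifted : ∀ m j → sumBelow m (λ i → suc i + j) ≡ tri m + m * j
sumBelow-shifted zero    j = refl
sumBelow-shifted (suc m) j = begin
  sumBelow (suc m) (λ i → suc i + j)          ≡⟨ sumBelow-snoc m (λ i → suc i + j) ⟩
  sumBelow m (λ i → suc i + j) + (suc m + j)  ≡⟨ cong (_+ (suc m + j)) (sumBelow-shifted m j) ⟩
  tri m + m * j + (suc m + j)                 ≡⟨ regroup (tri m) m j ⟩
  tri m + suc m + suc m * j                   ∎
  where
  open ≡-Reasoning
  regroup : ∀ t m j → t + m * j + (suc m + j) ≡ t + suc m + suc m * j
  regroup = solve-∀

-- Σ_{i<k} |i + 1 − j| + tri k = j·k when k ≤ j: each term pairs up to j.
sumBelow-abs-short : ∀ k j → k ≤ j → sumBelow k (λ i → ∣ suc i - j ∣) + tri k ≡ j * k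
sumBelow-abs-short zero    j _  = sym (*-zeroʳ j)
sumBelow-abs-short (suc k) j k< = begin
  sumBelow (suc k) g + (tri k + suc k)   ≡⟨ cong (_+ (tri k + suc k)) (sumBelow-snoc k g) ⟩
  sumBelow k g + x + (tri k + suc k)     ≡⟨ regroup (sumBelow k g) x (tri k) (suc k) ⟩
  (sumBelow k g + tri k) + (x + suc k)   ≡⟨ cong₂ _+_ (sumBelow-abs-short k j (<⇒≤ k<)) (∣-∣+≡ (suc k) j k<) ⟩
  j * k + j                              ≡⟨ +-comm (j * k) j ⟩
  j + j * k                              ≡⟨ sym (*-suc j k) ⟩
  j * suc k                              ∎
  where
  open ≡-Reasoning
  g = λ i → ∣ suc i - j ∣
  x = ∣ suc k - j ∣
  ∣-∣+≡ : ∀ m j → m ≤ j → ∣ m - j ∣ + m ≡ j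
  ∣-∣+≡ m j m≤j = trans (cong (_+ m) (m≤n⇒∣m-n∣≡n∸m m≤j)) (m∸n+n≡m m≤j)
  regroup : ∀ s x t m → s + x + (t + m) ≡ (s + t) + (x + m)
  regroup = solve-∀

sumBelow-abs : ∀ j K → j ≤ K → sumBelow K (λ i → ∣ suc i - j ∣) + j * K + j ≡ tri K + j * j
sumBelow-abs j zero z≤n = refl
sumBelow-abs j (suc K) j≤ with j ≤? K
... | yes j≤K = begin
  sumBelow (suc K) g + j * suc K + j            ≡⟨ cong (λ s → s + j * suc K + j) (sumBelow-snoc K g) ⟩
  sumBelow K g + x + j * suc K + j              ≡⟨ regroup (sumBelow K g) x j K ⟩
  (sumBelow K g + j * K + j) + (x + j)          ≡⟨ cong₂ _+_ (sumBelow-abs j K j≤K) x+j ⟩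
  tri K + j * j + suc K                         ≡⟨ swap (tri K) (j * j) (suc K) ⟩
  tri K + suc K + j * j                         ∎
  where
  open ≡-Reasoning
  g = λ i → ∣ suc i - j ∣
  x = ∣ suc K - j ∣
  x+j : x + j ≡ suc K
  x+j = trans (cong (_+ j) (trans (∣-∣-comm (suc K) j) (m≤n⇒∣m-n∣≡n∸m j≤))) (m∸n+n≡m j≤)
  regroup : ∀ s x j K → s + x + j * suc K + j ≡ (s + j * K + j) + (x + j)
  regroup = solve-∀
  swap : ∀ t q m → t + q + m ≡ t + m + q
  swap = solve-∀
... | no j≰K with ≤-antisym j≤ (≰⇒> j≰K)
...   | refl = begin
  S + j * j + j         ≡⟨ +-assoc S (j * j) j ⟩
  S + (j * j + j)       ≡⟨ cong (S +_) (sym (tri-double j)) ⟩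
  S + (tri j + tri j)   ≡⟨ sym (+-assoc S (tri j) (tri j)) ⟩
  S + tri j + tri j     ≡⟨ cong (_+ tri j) (sumBelow-abs-short j j ≤-refl) ⟩
  j * j + tri j         ≡⟨ +-comm (j * j) (tri j) ⟩
  tri j + j * j         ∎
  where
  open ≡-Reasoning
  S = sumBelow j (λ i → ∣ suc i - j ∣)

branchTotal : ℕ → ℕ × ℕ → ℕ
branchTotal zero    p = 0
branchTotal (suc ℓ) p = branchTotal ℓ p + sumBelow (suc ℓ) (λ i → D (suc ℓ , suc i) p)

sumBelow-labels : ∀ ℓ p → sumBelow (suc (tri ℓ)) (λ x → D (decode x) p) ≡ D (0 , 0) p + branchTotal ℓ p
sumBelow-labels zero    p = refl
sumBelow-labels (suc ℓ) p = begin
  sumBelow (suc (tri ℓ) + suc ℓ) h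
    ≡⟨ sumBelow-+ (suc (tri ℓ)) (suc ℓ) h ⟩
  sumBelow (suc (tri ℓ)) h + sumBelow (suc ℓ) (λ i → h (suc (tri ℓ + i)))
    ≡⟨ cong₂ _+_ (sumBelow-labels ℓ p) (sumBelow-cong (suc ℓ) newBranch) ⟩
  D (0 , 0) p + branchTotal ℓ p + sumBelow (suc ℓ) (λ i → D (suc ℓ , suc i) p)
    ≡⟨ +-assoc (D (0 , 0) p) _ _ ⟩
  D (0 , 0) p + branchTotal (suc ℓ) p
    ∎
  where
  open ≡-Reasoning
  h = λ x → D (decode x) p
  newBranch : ∀ i → i < suc ℓ → h (suc (tri ℓ + i)) ≡ D (suc ℓ , suc i) p
  newBranch i i< = trans (cong (λ x → D (decode x) p) (sym (+-suc (tri ℓ) i)))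
                         (cong (λ q → D q p) (decode-node ℓ (suc i) (s≤s z≤n) i<))

row-other : ∀ K K′ j → K ≢ K′ → sumBelow K (λ i → D (K , suc i) (K′ , j)) ≡ tri K + K * j
row-other K K′ j K≢K′ = trans (sumBelow-cong K (λ i _ → D-other-branch K≢K′ (suc i) j)) (sumBelow-shifted K j)

row-same : ∀ K j → j ≤ K → sumBelow K (λ i → D (K , suc i) (K , j)) + j * K + j ≡ tri K + j * j
row-same K j j≤K = trans (cong (λ s → s + j * K + j) (sumBelow-cong K (λ i _ → D-same-branch K (suc i) j)))
                         (sumBelow-abs j K j≤K)

-- The transmission of the centre: C ℓ = tri 1 + tri 2 + ⋯ + tri ℓ.
C : ℕ → ℕ
C zero    = 0
C (suc ℓ) = C ℓ + tri (suc ℓ)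

branchTotal-centre : ∀ ℓ → branchTotal ℓ (0 , 0) ≡ C ℓ
branchTotal-centre zero    = refl
branchTotal-centre (suc ℓ) = cong₂ _+_ (branchTotal-centre ℓ)
  (trans (row-other (suc ℓ) 0 0 (λ ())) (trans (cong (tri (suc ℓ) +_) (*-zeroʳ (suc ℓ))) (+-identityʳ _)))

branchTotal-beyond : ∀ ℓ K j → ℓ < K → branchTotal ℓ (K , j) ≡ C ℓ + j * tri ℓ
branchTotal-beyond zero    K j _  = sym (*-zeroʳ j)
branchTotal-beyond (suc ℓ) K j ℓ< = begin
  branchTotal ℓ (K , j) + sumBelow (suc ℓ) (λ i → D (suc ℓ , suc i) (K , j))
    ≡⟨ cong₂ _+_ (branchTotal-beyond ℓ K j (<-trans (n<1+n ℓ) ℓ<)) (row-other (suc ℓ) K j (<⇒≢ ℓ<)) ⟩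
  C ℓ + j * tri ℓ + (tri ℓ + suc ℓ + suc ℓ * j)
    ≡⟨ regroup (C ℓ) j (tri ℓ) (suc ℓ) ⟩
  C ℓ + (tri ℓ + suc ℓ) + j * (tri ℓ + suc ℓ)
    ∎
  where
  open ≡-Reasoning
  regroup : ∀ c j t m → c + j * t + (t + m + m * j) ≡ c + (t + m) + j * (t + m)
  regroup = solve-∀

branchTotal-within : ∀ ℓ K j → j ≤ K → K ≤ ℓ →
                     branchTotal ℓ (K , j) + (j * K + j * K) + j ≡ C ℓ + j * tri ℓ + j * j
branchTotal-within zero    .0 .0 z≤n z≤n = refl
branchTotal-within (suc ℓ) K j j≤K K≤ with K ≟ suc ℓ
... | yes refl = begin
  branchTotal ℓ (suc ℓ , j) + S + (j * suc ℓ + j * suc ℓ) + j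
    ≡⟨ cong (λ b → b + S + (j * suc ℓ + j * suc ℓ) + j) (branchTotal-beyond ℓ (suc ℓ) j ≤-refl) ⟩
  C ℓ + j * tri ℓ + S + (j * suc ℓ + j * suc ℓ) + j
    ≡⟨ regroup₁ (C ℓ) j (tri ℓ) S (suc ℓ) ⟩
  C ℓ + j * tri ℓ + j * suc ℓ + (S + j * suc ℓ + j)
    ≡⟨ cong (C ℓ + j * tri ℓ + j * suc ℓ +_) (row-same (suc ℓ) j j≤K) ⟩
  C ℓ + j * tri ℓ + j * suc ℓ + (tri ℓ + suc ℓ + j * j)
    ≡⟨ regroup₂ (C ℓ) j (tri ℓ) (suc ℓ) ⟩
  C ℓ + (tri ℓ + suc ℓ) + j * (tri ℓ + suc ℓ) + j * j
    ∎
  where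
  open ≡-Reasoning
  S = sumBelow (suc ℓ) (λ i → D (suc ℓ , suc i) (suc ℓ , j))
  regroup₁ : ∀ c j t S m → c + j * t + S + (j * m + j * m) + j ≡ c + j * t + j * m + (S + j * m + j)
  regroup₁ = solve-∀
  regroup₂ : ∀ c j t m → c + j * t + j * m + (t + m + j * j) ≡ c + (t + m) + j * (t + m) + j * j
  regroup₂ = solve-∀
... | no K≢ = begin
  branchTotal ℓ (K , j) + R + X + j
    ≡⟨ cong (λ r → branchTotal ℓ (K , j) + r + X + j) (row-other (suc ℓ) K j (K≢ ∘ sym)) ⟩
  branchTotal ℓ (K , j) + (tri ℓ + suc ℓ + suc ℓ * j) + X + j
    ≡⟨ regroup₁ (branchTotal ℓ (K , j)) (tri ℓ) (suc ℓ) j X ⟩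
  (branchTotal ℓ (K , j) + X + j) + (tri ℓ + suc ℓ + suc ℓ * j)
    ≡⟨ cong (_+ (tri ℓ + suc ℓ + suc ℓ * j)) (branchTotal-within ℓ K j j≤K (≤-pred (≤∧≢⇒< K≤ K≢))) ⟩
  C ℓ + j * tri ℓ + j * j + (tri ℓ + suc ℓ + suc ℓ * j)
    ≡⟨ regroup₂ (C ℓ) j (tri ℓ) (suc ℓ) ⟩
  C ℓ + (tri ℓ + suc ℓ) + j * (tri ℓ + suc ℓ) + j * j
    ∎
  where
  open ≡-Reasoning
  R = sumBelow (suc ℓ) (λ i → D (suc ℓ , suc i) (K , j))
  X = j * K + j * K
  regroup₁ : ∀ B t m j X → B + (t + m + m * j) + X + j ≡ (B + X + j) + (t + m + m * j)
  regroup₁ = solve-∀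
  regroup₂ : ∀ c j t m → c + j * t + j * j + (t + m + m * j) ≡ c + (t + m) + j * (t + m) + j * j
  regroup₂ = solve-∀

module Transmission (ℓ : ℕ) (3≤ℓ : 3 ≤ ℓ) where
  open Distance ℓ 3≤ℓ public

  Tr-labels : ∀ v → Tr G v ≡ D (0 , 0) (pos v) + branchTotal ℓ (pos v)
  Tr-labels v = begin
    sum (map (λ u → dist G u v) (allFin n))
      ≡⟨ cong sum (map-cong (λ u → dist-eq u v) (allFin n)) ⟩
    sum (map (λ u → h (toℕ u)) (tabulate {n = n} (λ i → i)))
      ≡⟨ cong sum (map-tabulate {n = n} (λ i → i) (λ u → h (toℕ u))) ⟩
    sum (tabulate {n = n} (λ u → h (toℕ u)))
      ≡⟨ sum-tabulate n h ⟩
    sumBelow (suc (sum (oneTo ℓ))) h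
      ≡⟨ cong (λ m → sumBelow (suc m) h) (sum-oneTo ℓ) ⟩
    sumBelow (suc (tri ℓ)) h
      ≡⟨ sumBelow-labels ℓ (pos v) ⟩
    D (0 , 0) (pos v) + branchTotal ℓ (pos v)
      ∎
    where
    open ≡-Reasoning
    h = λ x → D (decode x) (pos v)

  Tr-centre : ∀ v → toℕ v ≡ 0 → Tr G v ≡ C ℓ
  Tr-centre v v≡0 = begin
    Tr G v                                    ≡⟨ Tr-labels v ⟩
    D (0 , 0) (pos v) + branchTotal ℓ (pos v) ≡⟨ cong (λ x → D (0 , 0) (decode x) + branchTotal ℓ (decode x)) v≡0 ⟩
    branchTotal ℓ (0 , 0)                     ≡⟨ branchTotal-centre ℓ ⟩
    C ℓ                                       ∎
    where open ≡-Reasoning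

  Tr-node : ∀ v k j → k < ℓ → 1 ≤ j → j ≤ suc k → toℕ v ≡ tri k + j →
            Tr G v + (j * suc k + j * suc k) ≡ C ℓ + j * tri ℓ + j * j
  Tr-node v k j k< 1≤j j≤ v≡ = begin
    Tr G v + X                                      ≡⟨ cong (_+ X) (Tr-labels v) ⟩
    D (0 , 0) (pos v) + branchTotal ℓ (pos v) + X   ≡⟨ cong (λ p → D (0 , 0) p + branchTotal ℓ p + X) pos-v ⟩
    j + branchTotal ℓ (suc k , j) + X               ≡⟨ rotate j (branchTotal ℓ (suc k , j)) X ⟩
    branchTotal ℓ (suc k , j) + X + j               ≡⟨ branchTotal-within ℓ (suc k) j j≤ k< ⟩
    C ℓ + j * tri ℓ + j * j                         ∎
    where
    open ≡-Reasoning
    X = j * suc k + j * suc k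
    pos-v : pos v ≡ (suc k , j)
    pos-v = trans (cong decode v≡) (decode-node k j 1≤j j≤)
    rotate : ∀ j b x → j + b + x ≡ b + x + j
    rotate = solve-∀

-- Two branch vertices (depth j on branch K, depth j′ on branch K′) have
-- equal transmissions iff Balanced ℓ j K j′ K′ holds; this is the equation
-- Tr + 2jK = C ℓ + j·tri ℓ + j² doubled, with C ℓ cancelled and
-- 2·tri ℓ = ℓ² + ℓ.
Balanced : ℕ → ℕ → ℕ → ℕ → ℕ → Set
Balanced ℓ j K j′ K′ =
  j * (ℓ * ℓ + ℓ) + 2 * (j * j) + 4 * (j′ * K′) ≡ j′ * (ℓ * ℓ + ℓ) + 2 * (j′ * j′) + 4 * (j * K)

doubled : ∀ {X c N L} j K j′ K′ → X + (j * K + j * K) ≡ c + j * N + j * j → N + N ≡ L →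
          2 * X + (4 * (j * K) + 4 * (j′ * K′)) ≡ 2 * c + (j * L + 2 * (j * j) + 4 * (j′ * K′))
doubled {X} {c} {N} {L} j K j′ K′ hX N+N≡L = begin
  2 * X + (4 * (j * K) + 4 * (j′ * K′))                ≡⟨ gather X (j * K) (j′ * K′) ⟩
  2 * (X + (j * K + j * K)) + 4 * (j′ * K′)            ≡⟨ cong (λ z → 2 * z + 4 * (j′ * K′)) hX ⟩
  2 * (c + j * N + j * j) + 4 * (j′ * K′)              ≡⟨ spread c j N (j′ * K′) ⟩
  2 * c + (j * (N + N) + 2 * (j * j) + 4 * (j′ * K′))  ≡⟨ cong (λ z → 2 * c + (j * z + 2 * (j * j) + 4 * (j′ * K′))) N+N≡L ⟩
  2 * c + (j * L + 2 * (j * j) + 4 * (j′ * K′))        ∎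
  where
  open ≡-Reasoning
  gather : ∀ X a b → 2 * X + (4 * a + 4 * b) ≡ 2 * (X + (a + a)) + 4 * b
  gather = solve-∀
  spread : ∀ c j N b → 2 * (c + j * N + j * j) + 4 * b ≡ 2 * c + (j * (N + N) + 2 * (j * j) + 4 * b)
  spread = solve-∀

balanced⇔ : ∀ {X Y c N} ℓ j K j′ K′ → N + N ≡ ℓ * ℓ + ℓ →
            X + (j * K + j * K) ≡ c + j * N + j * j →
            Y + (j′ * K′ + j′ * K′) ≡ c + j′ * N + j′ * j′ →
            X ≡ Y ⇔ Balanced ℓ j K j′ K′
balanced⇔ {X} {Y} {c} ℓ j K j′ K′ N+N≡L hX hY = mk⇔ to from
  where
  A = 4 * (j * K) + 4 * (j′ * K′)
  hx = doubled {X} j K j′ K′ hX N+N≡L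
  hy = trans (cong (2 * Y +_) (+-comm (4 * (j * K)) (4 * (j′ * K′)))) (doubled {Y} j′ K′ j K hY N+N≡L)
  to : X ≡ Y → Balanced ℓ j K j′ K′
  to refl = +-cancelˡ-≡ (2 * c) _ _ (trans (sym hx) hy)
  from : Balanced ℓ j K j′ K′ → X ≡ Y
  from bal = *-cancelˡ-≡ X Y 2 (+-cancelʳ-≡ A _ _ (trans hx (trans (cong (2 * c +_) bal) (sym hy))))

SquarePlusOne : ℕ → Set
SquarePlusOne ℓ = ∃[ r ] (2 ≤ r × ℓ ≡ r * r + 1)

root≥2 : ∀ r → 3 ≤ r * r + 1 → 2 ≤ r
root≥2 zero          (s≤s ())
root≥2 (suc zero)    (s≤s (s≤s ()))
root≥2 (suc (suc r)) _ = s≤s (s≤s z≤n)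

-- Depths two or more apart never balance: the right side exceeds the left
-- even for the extreme branch lengths K = j and K′ = ℓ.
far-unbalanced : ∀ ℓ j K j′ K′ → 1 ≤ j → j ≤ K → 2 + j ≤ j′ → j′ ≤ K′ → K′ ≤ ℓ → ¬ Balanced ℓ j K j′ K′
far-unbalanced ℓ (suc p) K j′ K′ _ j≤K j+2≤j′ j′≤K′ K′≤ℓ bal
  with m≤n⇒∃[o]m+o≡n j+2≤j′ | m≤n⇒∃[o]m+o≡n (≤-trans j′≤K′ K′≤ℓ)
... | q , refl | e , refl = <-irrefl bal (begin-strict
  j * L + 2 * (j * j) + 4 * (j′ * K′)  ≤⟨ +-monoʳ-≤ _ (*-monoʳ-≤ 4 (*-monoʳ-≤ j′ K′≤ℓ)) ⟩
  j * L + 2 * (j * j) + 4 * (j′ * ℓ)   <⟨ m<m+n _ (s≤s z≤n) ⟩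
  j * L + 2 * (j * j) + 4 * (j′ * ℓ) + suc excess
                                       ≡⟨ far-gap p q e ⟩
  j′ * L + 2 * (j′ * j′) + 4 * (j * j) ≤⟨ +-monoʳ-≤ _ (*-monoʳ-≤ 4 (*-monoʳ-≤ j j≤K)) ⟩
  j′ * L + 2 * (j′ * j′) + 4 * (j * K) ∎)
  where
  open ≤-Reasoning
  j = suc p
  L = ℓ * ℓ + ℓ
  -- how far the right side exceeds the left (minus one), for K = j, K′ = ℓ
  excess : ℕ
  excess = 7 + 6 * p + 14 * q + 2 * e + 2 * (p * p) + 7 * (q * q) + 2 * (e * e) + q * q * q
           + 7 * (p * q) + 7 * (q * e) + 2 * (p * q * q) + p * p * q + 2 * (q * q * e) + q * e * e + 2 * (p * q * e)
  far-gap : ∀ p q e → let j = suc p ; j′ = 2 + j + q ; ℓ = j′ + e ; L = ℓ * ℓ + ℓ in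
    j * L + 2 * (j * j) + 4 * (j′ * ℓ)
      + suc (7 + 6 * p + 14 * q + 2 * e + 2 * (p * p) + 7 * (q * q) + 2 * (e * e) + q * q * q
             + 7 * (p * q) + 7 * (q * e) + 2 * (p * q * q) + p * p * q + 2 * (q * q * e) + q * e * e + 2 * (p * q * e))
    ≡ j′ * L + 2 * (j′ * j′) + 4 * (j * j)
  far-gap = solve-∀

-- Adjacent depths j, j + 1 do not balance when the deeper vertex lies on a
-- branch that is not longer: the left side gains at most 4ℓ ≤ ℓ² + ℓ.
near-low-unbalanced : ∀ ℓ j K K′ → 3 ≤ ℓ → K′ ≤ K → K ≤ ℓ → ¬ Balanced ℓ j K (suc j) K′
near-low-unbalanced ℓ j K K′ 3≤ℓ K′≤K K≤ℓ bal = <-irrefl bal (begin-strict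
  j * L + 2 * (j * j) + 4 * (suc j * K′)        ≤⟨ +-monoʳ-≤ (j * L + 2 * (j * j)) (*-monoʳ-≤ 4 (*-monoʳ-≤ (suc j) K′≤K)) ⟩
  j * L + 2 * (j * j) + 4 * (suc j * K)         ≡⟨ split j L K ⟩
  j * L + 2 * (j * j) + 4 * (j * K) + 4 * K     ≤⟨ +-monoʳ-≤ (j * L + 2 * (j * j) + 4 * (j * K)) (≤-trans (*-monoʳ-≤ 4 K≤ℓ) (four-ℓ≤ ℓ 3≤ℓ)) ⟩
  j * L + 2 * (j * j) + 4 * (j * K) + L         <⟨ m<m+n _ (s≤s z≤n) ⟩
  j * L + 2 * (j * j) + 4 * (j * K) + L + suc (4 * j + 1)
                                                ≡⟨ near-gap j L K ⟩
  suc j * L + 2 * (suc j * suc j) + 4 * (j * K) ∎)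
  where
  open ≤-Reasoning
  L = ℓ * ℓ + ℓ
  split : ∀ j L K → j * L + 2 * (j * j) + 4 * (suc j * K) ≡ j * L + 2 * (j * j) + 4 * (j * K) + 4 * K
  split = solve-∀
  near-gap : ∀ j L K → j * L + 2 * (j * j) + 4 * (j * K) + L + suc (4 * j + 1)
                       ≡ suc j * L + 2 * (suc j * suc j) + 4 * (j * K)
  near-gap = solve-∀

slack-impossible : ∀ s c a r → 3 ≤ s → 1 ≤ c → a ≤ c → s + c + 4 * a ≢ r * r + (2 * (s * c) + c * c + 2)
slack-impossible s c a r 3≤s 1≤c a≤c eq with m≤n⇒∃[o]m+o≡n 3≤s | m≤n⇒∃[o]m+o≡n 1≤c
... | t , refl | c₁ , refl = <-irrefl eq (begin-strict
  s + c + 4 * a                       ≤⟨ +-monoʳ-≤ (s + c) (*-monoʳ-≤ 4 a≤c) ⟩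
  s + c + 4 * c                       <⟨ m<m+n _ (s≤s z≤n) ⟩
  s + c + 4 * c + suc (3 * c₁ + t + 2 * (t * c₁) + c₁ * c₁)
                                      ≡⟨ slack-gap t c₁ ⟩
  2 * (s * c) + c * c + 2             ≤⟨ m≤n+m _ (r * r) ⟩
  r * r + (2 * (s * c) + c * c + 2)   ∎)
  where
  open ≤-Reasoning
  slack-gap : ∀ t c₁ → (3 + t) + (1 + c₁) + 4 * (1 + c₁) + suc (3 * c₁ + t + 2 * (t * c₁) + c₁ * c₁)
                       ≡ 2 * ((3 + t) * (1 + c₁)) + (1 + c₁) * (1 + c₁) + 2
  slack-gap = solve-∀

reduced-solutions : ∀ s a b r → 3 ≤ s →
                    s + (a + b) + 4 * a ≡ r * r + (2 * (s * (a + b)) + (a + b) * (a + b) + 2) →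
                    a ≡ 0 × b ≡ 0 × s ≡ r * r + 2
reduced-solutions s zero zero r _ eq = refl , refl , trans (sym (drop-left s)) (trans eq (drop-right s (r * r)))
  where
  drop-left : ∀ s → s + (0 + 0) + 4 * 0 ≡ s
  drop-left = solve-∀
  drop-right : ∀ s q → q + (2 * (s * (0 + 0)) + (0 + 0) * (0 + 0) + 2) ≡ q + 2
  drop-right = solve-∀
reduced-solutions s zero    (suc b) r 3≤s eq = ⊥-elim (slack-impossible s (suc b) 0 r 3≤s (s≤s z≤n) z≤n eq)
reduced-solutions s (suc a) b       r 3≤s eq =
  ⊥-elim (slack-impossible s (suc a + b) (suc a) r 3≤s (s≤s z≤n) (m≤m+n (suc a) b) eq)

-- Write K = j + a, K′ = K + y, ℓ = K′ + b, x = j + 1, s = x + y, c = a + b.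
-- Then Balanced says s + c + 4a = |x − y|² + 2sc + c² + 2 (using
-- x² + y² = 2xy + |x − y|²); by reduced-solutions the slack c vanishes and
-- ℓ = s − 1 = |x − y|² + 1.
near-high-square : ∀ ℓ j K K′ → 3 ≤ ℓ → 1 ≤ j → j ≤ K → K < K′ → K′ ≤ ℓ →
                   Balanced ℓ j K (suc j) K′ → SquarePlusOne ℓ
near-high-square ℓ j K K′ 3≤ℓ 1≤j j≤K K<K′ K′≤ℓ bal
  with m≤n⇒∃[o]m+o≡n j≤K | m≤n⇒∃[o]m+o≡n K<K′ | m≤n⇒∃[o]m+o≡n K′≤ℓ
... | a , refl | y₀ , refl | b , refl = conclude a b 3≤ℓ (reduced-solutions s a b r 3≤s reduced)
  where
  x = suc j
  y = suc y₀
  s = x + y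
  r = ∣ x - y ∣
  W = 2 * (s * (a + b)) + (a + b) * (a + b) + 2
  Rh = suc j * (ℓ * ℓ + ℓ) + 2 * (suc j * suc j) + 4 * (j * K)
  key : ∀ j a y₀ b → let K = j + a ; K′ = suc K + y₀ ; ℓ = K′ + b ; L = ℓ * ℓ + ℓ
                         x = suc j ; y = suc y₀ ; s = x + y ; c = a + b in
    suc j * L + 2 * (suc j * suc j) + 4 * (j * K) + (2 * (x * y) + (s + c + 4 * a))
    ≡ j * L + 2 * (j * j) + 4 * (suc j * K′) + ((x * x + y * y) + (2 * (s * c) + c * c + 2))
  key = solve-∀
  reduced : s + (a + b) + 4 * a ≡ r * r + (2 * (s * (a + b)) + (a + b) * (a + b) + 2)
  reduced = +-cancelˡ-≡ (2 * (x * y)) _ _ (begin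
    2 * (x * y) + (s + (a + b) + 4 * a)
      ≡⟨ +-cancelˡ-≡ Rh _ _ (trans (key j a y₀ b) (cong (_+ ((x * x + y * y) + W)) bal)) ⟩
    (x * x + y * y) + W                               ≡⟨ cong (_+ W) (square-gap x y) ⟩
    (2 * (x * y) + r * r) + W                         ≡⟨ +-assoc (2 * (x * y)) (r * r) W ⟩
    2 * (x * y) + (r * r + W)                         ∎)
    where open ≡-Reasoning
  3≤s : 3 ≤ s
  3≤s = s≤s (≤-trans (s≤s (s≤s z≤n)) (+-monoˡ-≤ y 1≤j))
  conclude : ∀ a b → 3 ≤ suc (j + a) + y₀ + b → a ≡ 0 × b ≡ 0 × s ≡ r * r + 2 →
             SquarePlusOne (suc (j + a) + y₀ + b)
  conclude .0 .0 3≤ℓ′ (refl , refl , s≡) = r , root≥2 r (subst (3 ≤_) ℓ≡ 3≤ℓ′) , ℓ≡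
    where
    ends : ∀ j y₀ → suc (suc (j + 0) + y₀ + 0) ≡ suc j + suc y₀
    ends = solve-∀
    ℓ≡ : suc (j + 0) + y₀ + 0 ≡ r * r + 1
    ℓ≡ = suc-injective (trans (ends j y₀) (trans s≡ (+-suc (r * r) 1)))

balanced-deeper : ∀ ℓ j K j′ K′ → 3 ≤ ℓ → 1 ≤ j → j ≤ K → K ≤ ℓ → j′ ≤ K′ → K′ ≤ ℓ → j < j′ →
                  Balanced ℓ j K j′ K′ → SquarePlusOne ℓ
balanced-deeper ℓ j K j′ K′ 3≤ℓ 1≤j j≤K K≤ℓ j′≤K′ K′≤ℓ j<j′ bal with j′ ≟ suc j
... | no j′≢ = ⊥-elim (far-unbalanced ℓ j K j′ K′ 1≤j j≤K (≤∧≢⇒< j<j′ (j′≢ ∘ sym)) j′≤K′ K′≤ℓ bal)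
... | yes refl with K′ ≤? K
...   | yes K′≤K = ⊥-elim (near-low-unbalanced ℓ j K K′ 3≤ℓ K′≤K K≤ℓ bal)
...   | no K′≰K  = near-high-square ℓ j K K′ 3≤ℓ 1≤j j≤K (≰⇒> K′≰K) K′≤ℓ bal

balanced-level : ∀ ℓ j K K′ → 1 ≤ j → Balanced ℓ j K j K′ → K ≡ K′
balanced-level ℓ (suc j₀) K K′ _ bal =
  sym (*-cancelˡ-≡ K′ K (suc j₀) (*-cancelˡ-≡ _ _ 4 (+-cancelˡ-≡ (suc j₀ * (ℓ * ℓ + ℓ) + 2 * (suc j₀ * suc j₀)) _ _ bal)))

balanced-equal : ∀ ℓ j K j′ K′ → 3 ≤ ℓ → ¬ SquarePlusOne ℓ →
                 1 ≤ j → j ≤ K → K ≤ ℓ → 1 ≤ j′ → j′ ≤ K′ → K′ ≤ ℓ →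
                 Balanced ℓ j K j′ K′ → j ≡ j′ × K ≡ K′
balanced-equal ℓ j K j′ K′ 3≤ℓ ¬sq 1≤j j≤K K≤ℓ 1≤j′ j′≤K′ K′≤ℓ bal with <-cmp j j′
... | tri< j<j′ _ _ = ⊥-elim (¬sq (balanced-deeper ℓ j K j′ K′ 3≤ℓ 1≤j j≤K K≤ℓ j′≤K′ K′≤ℓ j<j′ bal))
... | tri> _ _ j′<j = ⊥-elim (¬sq (balanced-deeper ℓ j′ K′ j K 3≤ℓ 1≤j′ j′≤K′ K′≤ℓ j≤K K≤ℓ j′<j (sym bal)))
... | tri≈ _ refl _ = refl , balanced-level ℓ j K K′ 1≤j bal

-- The centre never shares its transmission with a branch vertex:
-- 2jK ≤ 2jℓ ≤ j·tri ℓ < j·tri ℓ + j².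
centre-unbalanced : ∀ ℓ j K X → 3 ≤ ℓ → 1 ≤ j → K ≤ ℓ → X + (j * K + j * K) ≢ X + j * tri ℓ + j * j
centre-unbalanced ℓ j K X 3≤ℓ 1≤j K≤ℓ eq = <-irrefl eq (begin-strict
  X + (j * K + j * K)    ≡⟨ cong (X +_) (sym (*-distribˡ-+ j K K)) ⟩
  X + j * (K + K)        ≤⟨ +-monoʳ-≤ X (*-monoʳ-≤ j (≤-trans (+-mono-≤ K≤ℓ K≤ℓ) (double≤tri ℓ 3≤ℓ))) ⟩
  X + j * tri ℓ          <⟨ m<m+n (X + j * tri ℓ) (*-mono-≤ 1≤j 1≤j) ⟩
  X + j * tri ℓ + j * j  ∎)
  where open ≤-Reasoning

-- The collision behind the exceptions: for ℓ = (a + 1)² + 1 and 2t = a² + a,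
-- depth t on the branch of length t balances depth t + 1 on the branch of
-- length ℓ.  Doubling expresses both sides through 2t.
square-balanced : ∀ a t → t + t ≡ a * a + a →
                  Balanced (suc (suc a * suc a)) t t (suc t) (suc (suc a * suc a))
square-balanced a t 2t≡ = *-cancelˡ-≡ _ _ 2 (begin
  2 * (t * L + 2 * (t * t) + 4 * (suc t * ℓ))          ≡⟨ left-doubled t ℓ ⟩
  G (t + t)                                            ≡⟨ cong G 2t≡ ⟩
  G (a * a + a)                                        ≡⟨ at-square a ⟩
  H (a * a + a)                                        ≡⟨ cong H (sym 2t≡) ⟩
  H (t + t)                                            ≡⟨ sym (right-doubled t ℓ) ⟩
  2 * (suc t * L + 2 * (suc t * suc t) + 4 * (t * t))  ∎)
  where
  open ≡-Reasoning
  ℓ = suc (suc a * suc a)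
  L = ℓ * ℓ + ℓ
  G H : ℕ → ℕ
  G u = u * L + u * u + 4 * ((u + 2) * ℓ)
  H u = (u + 2) * L + (u + 2) * (u + 2) + 2 * (u * u)
  left-doubled : ∀ t ℓ → 2 * (t * (ℓ * ℓ + ℓ) + 2 * (t * t) + 4 * (suc t * ℓ))
                         ≡ (t + t) * (ℓ * ℓ + ℓ) + (t + t) * (t + t) + 4 * ((t + t + 2) * ℓ)
  left-doubled = solve-∀
  right-doubled : ∀ t ℓ → 2 * (suc t * (ℓ * ℓ + ℓ) + 2 * (suc t * suc t) + 4 * (t * t))
                          ≡ (t + t + 2) * (ℓ * ℓ + ℓ) + (t + t + 2) * (t + t + 2) + 2 * ((t + t) * (t + t))
  right-doubled = solve-∀
  at-square : ∀ a → let u = a * a + a ; ℓ = suc (suc a * suc a) ; L = ℓ * ℓ + ℓ in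
    u * L + u * u + 4 * ((u + 2) * ℓ) ≡ (u + 2) * L + (u + 2) * (u + 2) + 2 * (u * u)
  at-square = solve-∀

record OnBranch (ℓ v : ℕ) : Set where
  constructor onBranch
  field
    k j : ℕ
    k<ℓ : k < ℓ
    1≤j : 1 ≤ j
    j≤k+1 : j ≤ suc k
    v≡ : v ≡ tri k + j

centre-or-branch : ∀ ℓ v → v < suc (tri ℓ) → v ≡ 0 ⊎ OnBranch ℓ v
centre-or-branch ℓ v v< with label ℓ v v<
... | centre                 = inj₁ refl
... | node k j k< 1≤j j≤ = inj₂ (onBranch k j k< 1≤j j≤ refl)

module Irregularity (ℓ : ℕ) (3≤ℓ : 3 ≤ ℓ) where
  open Transmission ℓ 3≤ℓ

  centre≢branch : ∀ u v → toℕ u ≡ 0 → OnBranch ℓ (toℕ v) → Tr G u ≢ Tr G v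
  centre≢branch u v u≡0 (onBranch k j k< 1≤j j≤ v≡) Tr≡ =
    centre-unbalanced ℓ j (suc k) (C ℓ) 3≤ℓ 1≤j k<
      (trans (cong (_+ (j * suc k + j * suc k)) (trans (sym (Tr-centre u u≡0)) Tr≡)) (Tr-node v k j k< 1≤j j≤ v≡))

  irregular : ¬ SquarePlusOne ℓ → TransmissionIrregular G
  irregular ¬sq u v Tr≡ with centre-or-branch ℓ (toℕ u) (label< u) | centre-or-branch ℓ (toℕ v) (label< v)
  ... | inj₁ u≡0 | inj₁ v≡0 = toℕ-injective (trans u≡0 (sym v≡0))
  ... | inj₁ u≡0 | inj₂ bv  = ⊥-elim (centre≢branch u v u≡0 bv Tr≡)
  ... | inj₂ bu  | inj₁ v≡0 = ⊥-elim (centre≢branch v u v≡0 bu (sym Tr≡))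
  ... | inj₂ (onBranch k i k< 1≤i i≤ u≡) | inj₂ (onBranch k′ j k′< 1≤j j≤ v≡)
    with balanced-equal ℓ i (suc k) j (suc k′) 3≤ℓ ¬sq 1≤i i≤ k< 1≤j j≤ k′<
           (Equivalence.to (balanced⇔ ℓ i (suc k) j (suc k′) (tri-double ℓ)
              (Tr-node u k i k< 1≤i i≤ u≡) (Tr-node v k′ j k′< 1≤j j≤ v≡)) Tr≡)
  ...   | refl , refl = toℕ-injective (trans u≡ (sym v≡))

square-collision : ∀ a t → 1 ≤ a → 1 ≤ t → t + t ≡ a * a + a →
                   ¬ TransmissionIrregular (starlike (oneTo (suc (suc a * suc a))))
square-collision a (suc t₀) 1≤a _ 2t≡ irr = depths-differ (irr u v Tr≡)
  where
  t = suc t₀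
  K = suc a * suc a
  ℓ = suc K
  3≤ℓ : 3 ≤ ℓ
  3≤ℓ = s≤s (≤-trans (s≤s (s≤s z≤n)) (*-mono-≤ (s≤s 1≤a) (s≤s 1≤a)))
  open Transmission ℓ 3≤ℓ
  t≤K : t ≤ K
  t≤K = ≤-trans (m≤m+n t t) (≤-trans (≤-reflexive 2t≡) (≤-trans (m≤m+n (a * a + a) (suc a)) (≤-reflexive (square a))))
    where
    square : ∀ a → a * a + a + suc a ≡ suc a * suc a
    square = solve-∀
  t₀<ℓ : t₀ < ℓ
  t₀<ℓ = ≤-trans (n≤1+n t) (s≤s t≤K)
  u< : tri t₀ + t < suc (tri ℓ)
  u< = node-bound ℓ t₀ t t₀<ℓ ≤-refl
  v< : tri K + suc t < suc (tri ℓ)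
  v< = node-bound ℓ K (suc t) ≤-refl (s≤s t≤K)
  u v : Fin n
  u = vertex _ u<
  v = vertex _ v<
  u≡ : toℕ u ≡ tri t₀ + t
  u≡ = vertex-label _ u<
  v≡ : toℕ v ≡ tri K + suc t
  v≡ = vertex-label _ v<
  Tr≡ : Tr G u ≡ Tr G v
  Tr≡ = Equivalence.from (balanced⇔ {c = C ℓ} {N = tri ℓ} ℓ t t (suc t) ℓ (tri-double ℓ)
          (Tr-node u t₀ t t₀<ℓ (s≤s z≤n) ≤-refl u≡) (Tr-node v K (suc t) ≤-refl (s≤s z≤n) (s≤s t≤K) v≡))
          (square-balanced a t 2t≡)
  depths-differ : u ≢ v
  depths-differ u≡v = <-irrefl (begin
    t                                ≡⟨ sym (decode-depth t₀ t (s≤s z≤n) ≤-refl) ⟩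
    proj₂ (decode (tri t₀ + t))      ≡⟨ cong (λ w → proj₂ (decode w)) (trans (sym u≡) (trans (cong toℕ u≡v) v≡)) ⟩
    proj₂ (decode (tri K + suc t))   ≡⟨ decode-depth K (suc t) (s≤s z≤n) (s≤s t≤K) ⟩
    suc t                            ∎) (n<1+n t)
    where open ≡-Reasoning

exception-collides : ∀ ℓ → SquarePlusOne ℓ → ¬ TransmissionIrregular (starlike (oneTo ℓ))
exception-collides ℓ (suc a , s≤s 1≤a , refl) =
  subst (λ m → ¬ TransmissionIrregular (starlike (oneTo m))) (+-comm 1 (suc a * suc a))
        (square-collision a (tri a) 1≤a (≤-trans 1≤a (n≤tri a)) (tri-double a))

theorem2p5 : ∀ (ℓ : ℕ) → 3 ≤ ℓ →
    TransmissionIrregular (starlike (oneTo ℓ))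
    ⇔ (¬ (∃[ r ] (2 ≤ r × ℓ ≡ r * r + 1)))
theorem2p5 ℓ 3≤ℓ = mk⇔ (λ irr sq → exception-collides ℓ sq irr) (Irregularity.irregular ℓ 3≤ℓ)
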